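{- Let $G$ be a finite simple graph with vertex set $[1,n]$ and no isolated vertices, and let $G+\{0\}$ be the graph obtained from $G$ by adding a new vertex $0$ adjacent to every vertex of $G$. If $t(G)-t(1,n)=1$, then $t(G+\{0\})=t(G)+1$.
   Context: For a finite simple graph $H$, an $H$-CFF$(t,|V(H)|)$ is a family of subsets $B_v\subseteq[1,t]=\{1,\dots,t\}$, one for each vertex $v$, such that for every edge $\{a,b\}$: (i) $B_a\not\subseteq B_b$ and $B_b\not\subseteq B_a$, and (ii) for every vertex $w\notin\{a,b\}$, $B_w\not\subseteq B_a\cup B_b$. $t(H)$ is the minimum $t$ for which an $H$-CFF$(t,|V(H)|)$ exists. $t(1,n)$ is the minimum $t$ such that there exist $n$ subsets of $[1,t]$ none contained in another; equivalently $t(1,n)=\min\{t:\binom{t}{\lfloor t/2\rfloor}\ge n\}$. -}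

module Defs where

open import Level using (0ℓ)
open import Data.Nat using (ℕ; suc; _<_)
open import Data.Fin using (Fin; zero; suc)
open import Data.Fin.Subset using (Subset; _⊆_; _∪_)
open import Data.Product using (Σ; ∃; _×_; _,_)
open import Relation.Nullary using (¬_)
open import Relation.Binary.PropositionalEquality using (_≡_; _≢_)

record Graph (n : ℕ) : Set₁ where
  field
    Adj   : Fin n → Fin n → Set
    sym   : ∀ {u v} → Adj u v → Adj v u
    irrefl : ∀ {u} → ¬ Adj u u

open Graph public

NoIsolated : ∀ {n} → Graph n → Set
NoIsolated {n} G = ∀ (v : Fin n) → ∃ λ u → Adj G v u

-- G + {0}: new vertex `zero` adjacent to every old vertex `suc v`.
data AdjCone {n : ℕ} (G : Graph n) : Fin (suc n) → Fin (suc n) → Set where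
  old   : ∀ {u v} → Adj G u v → AdjCone G (suc u) (suc v)
  apexˡ : ∀ {v} → AdjCone G zero (suc v)
  apexʳ : ∀ {v} → AdjCone G (suc v) zero

cone : ∀ {n} → Graph n → Graph (suc n)
cone G = record { Adj = AdjCone G ; sym = s ; irrefl = i }
  where
    s : ∀ {u v} → AdjCone G u v → AdjCone G v u
    s (old a) = old (Graph.sym G a)
    s apexˡ = apexʳ
    s apexʳ = apexˡ
    i : ∀ {u} → ¬ AdjCone G u u
    i (old a) = Graph.irrefl G a

IsCFF : ∀ {n} → Graph n → (t : ℕ) → (Fin n → Subset t) → Set
IsCFF {n} H t B =
  ∀ (a b : Fin n) → Adj H a b →
    (¬ (B a ⊆ B b)) × (¬ (B b ⊆ B a)) ×
    (∀ (w : Fin n) → w ≢ a → w ≢ b → ¬ (B w ⊆ (B a ∪ B b)))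

HasCFF : ∀ {n} → Graph n → ℕ → Set
HasCFF {n} H t = Σ (Fin n → Subset t) (IsCFF H t)

HasAntichain : ℕ → ℕ → Set
HasAntichain n t = Σ (Fin n → Subset t) λ B →
  ∀ (i j : Fin n) → i ≢ j → ¬ (B i ⊆ B j)

IsMin : (ℕ → Set) → ℕ → Set
IsMin P m = P m × (∀ k → k < m → ¬ P k)

tGraph≡ : ∀ {n} → Graph n → ℕ → Set
tGraph≡ H m = IsMin (HasCFF H) m

t1≡ : ℕ → ℕ → Set
t1≡ n m = IsMin (HasAntichain n) m

-- Upper bound: give the apex the new point {0} and keep the old sets; this is a
-- (G + {0})-CFF because, G having no isolated vertices, every set of a G-CFF is
-- nonempty and no set contains another. Lower bound: take a (G + {0})-CFF on t(G) = t(1,n) + 1 points and let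
-- S be the set of the apex; S is nonempty since S ⊄ B_v. If S has two points x, y,
-- deleting both leaves n sets on t(1,n) - 1 points, still an antichain because
-- B_v ⊄ S ∪ B_u for v ≠ u. If S = {x}, then x lies in no B_v (otherwise S ⊆ B_v
-- ∪ B_u for a neighbour u of v), and deleting x leaves a G-CFF on t(G) - 1 points.
module Submission where

open import Defs
open import Data.Nat using (ℕ; suc; _+_)
open import Relation.Binary.PropositionalEquality using (_≡_)

open import Data.Nat using (zero; _<_)
open import Data.Nat.Properties using (+-comm; n<1+n; m<1+n⇒m<n∨m≡n)
open import Data.Fin using (Fin; zero; suc; punchIn)
open import Data.Fin.Properties using (punchIn-punchOut; suc-injective) renaming (_≟_ to _≟ᶠ_)
open import Data.Fin.Subset
  using (Subset; _⊆_; _∪_; _∈_; _∉_; ⊥; inside; outside; Nonempty; Empty)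
open import Data.Fin.Subset.Properties
  using (nonempty?; drop-there; drop-∷-⊆; ∉⊥; ⊆-trans; p⊆p∪q; q⊆p∪q; x∈p∪q⁻; x∈p∪q⁺;
         ∪-comm; ∪-identityˡ)
open import Data.Vec using (Vec; _∷_; here; there; lookup; removeAt)
open import Data.Vec.Properties using ([]=⇒lookup; lookup⇒[]=)
open import Data.Product using (∃-syntax; _×_; _,_; proj₁; proj₂)
open import Data.Sum using (_⊎_; inj₁; inj₂; [_,_]′)
open import Data.Empty using (⊥-elim)
open import Relation.Nullary using (¬_; yes; no)
open import Relation.Binary.PropositionalEquality
  using (_≢_; refl; trans; subst; cong) renaming (sym to ≡-sym)
open import Function using (_∘_)

removeAt-punchIn : ∀ {a} {A : Set a} {n} (xs : Vec A (suc n)) i j →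
                   lookup (removeAt xs i) j ≡ lookup xs (punchIn i j)
removeAt-punchIn (x ∷ xs)     zero    j           = refl
removeAt-punchIn (x ∷ y ∷ xs) (suc i) zero        = refl
removeAt-punchIn (x ∷ y ∷ xs) (suc i) (suc j)     = removeAt-punchIn (y ∷ xs) i j

module _ {t : ℕ} (x : Fin (suc t)) where

  ∈-removeAt⁺ : ∀ {p : Subset (suc t)} {z} → punchIn x z ∈ p → z ∈ removeAt p x
  ∈-removeAt⁺ {p} {z} z∈p =
    lookup⇒[]= z _ (trans (removeAt-punchIn p x z) ([]=⇒lookup z∈p))

  ∈-removeAt⁻ : ∀ (p : Subset (suc t)) {z} → z ∈ removeAt p x → punchIn x z ∈ p
  ∈-removeAt⁻ p {z} z∈p =
    lookup⇒[]= _ p (trans (≡-sym (removeAt-punchIn p x z)) ([]=⇒lookup z∈p))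

  removeAt-mono-⊆ : ∀ {p q : Subset (suc t)} → p ⊆ q → removeAt p x ⊆ removeAt q x
  removeAt-mono-⊆ {p} p⊆q = ∈-removeAt⁺ ∘ p⊆q ∘ ∈-removeAt⁻ p

  removeAt-∪-⊆ : ∀ (p q : Subset (suc t)) →
                 removeAt p x ∪ removeAt q x ⊆ removeAt (p ∪ q) x
  removeAt-∪-⊆ p q z∈ =
    [ removeAt-mono-⊆ {p} (p⊆p∪q q) , removeAt-mono-⊆ {q} (q⊆p∪q p q) ]′ (x∈p∪q⁻ _ _ z∈)

  removeAt-reflects-⊆ : ∀ {p q : Subset (suc t)} → (x ∈ p → x ∈ q) →
                        removeAt p x ⊆ removeAt q x → p ⊆ q
  removeAt-reflects-⊆ {p} {q} x∈q h {z} z∈p with x ≟ᶠ z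
  ... | yes refl = x∈q z∈p
  ... | no x≢z   = subst (_∈ q) (punchIn-punchOut x≢z)
    (∈-removeAt⁻ q (h (∈-removeAt⁺ (subst (_∈ p) (≡-sym (punchIn-punchOut x≢z)) z∈p))))

Empty⇒⊆ : ∀ {t} {p q : Subset t} → Empty p → p ⊆ q
Empty⇒⊆ empty z∈p = ⊥-elim (empty (_ , z∈p))

CoverFreeAt : ∀ {n t} → (Fin n → Subset t) → Fin n → Fin n → Set
CoverFreeAt B a b =
  ¬ (B a ⊆ B b) × ¬ (B b ⊆ B a) × (∀ w → w ≢ a → w ≢ b → ¬ (B w ⊆ B a ∪ B b))

CoverFreeAt-sym : ∀ {n t} {B : Fin n → Subset t} {a b} →
                  CoverFreeAt B a b → CoverFreeAt B b a
CoverFreeAt-sym {B = B} (a⊈b , b⊈a , w⊈a∪b) =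
  b⊈a , a⊈b , λ w w≢b w≢a → w⊈a∪b w w≢a w≢b ∘ subst (B w ⊆_) (∪-comm _ _)

module _ {n t : ℕ} {G : Graph n} {B : Fin n → Subset t}
         (noIsolated : NoIsolated G) (cff : IsCFF G t B) where

  IsCFF⇒Nonempty : ∀ v → Nonempty (B v)
  IsCFF⇒Nonempty v with nonempty? (B v)
  ... | yes nonempty = nonempty
  ... | no empty     = ⊥-elim (proj₁ (cff v _ (proj₂ (noIsolated v))) (Empty⇒⊆ empty))

  IsCFF⇒antichain : ∀ v w → w ≢ v → ¬ (B w ⊆ B v)
  IsCFF⇒antichain v w w≢v with noIsolated v
  ... | u , v~u with w ≟ᶠ u
  ...   | yes refl = proj₁ (proj₂ (cff v w v~u))
  ...   | no w≢u   = λ w⊆v → proj₂ (proj₂ (cff v u v~u)) w w≢v w≢u (⊆-trans w⊆v (p⊆p∪q _))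

IsCFF-removeAt : ∀ {n t} {H : Graph n} {B : Fin n → Subset (suc t)} x →
                 (∀ v → x ∉ B v) → IsCFF H (suc t) B →
                 IsCFF H t (λ v → removeAt (B v) x)
IsCFF-removeAt {B = B} x x∉ cff a b a~b with cff a b a~b
... | a⊈b , b⊈a , w⊈a∪b =
  a⊈b ∘ reflect a , b⊈a ∘ reflect b ,
  λ w w≢a w≢b → w⊈a∪b w w≢a w≢b ∘ reflect w ∘ (λ h z∈ → removeAt-∪-⊆ x (B a) (B b) (h z∈))
  where
  reflect : ∀ v {q} → removeAt (B v) x ⊆ removeAt q x → B v ⊆ q
  reflect v = removeAt-reflects-⊆ x (⊥-elim ∘ x∉ v)

-- y indexes the ground set left after deleting x.
removeAt²-antichain : ∀ {n t} (S : Subset (suc t)) (B : Fin n → Subset (suc t)) {x} {y} →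
                      x ∈ S → y ∈ removeAt S x →
                      (∀ v u → v ≢ u → ¬ (B v ⊆ S ∪ B u)) →
                      ∃[ k ] k < t × HasAntichain n k
removeAt²-antichain {t = suc t} S B {x} {y} x∈S y∈S v⊈S∪u =
  t , n<1+n t , (λ v → removeAt (removeAt (B v) x) y) , antichain
  where
  antichain : ∀ v u → v ≢ u → ¬ (removeAt (removeAt (B v) x) y ⊆ removeAt (removeAt (B u) x) y)
  antichain v u v≢u h = v⊈S∪u v u v≢u
    (removeAt-reflects-⊆ x (λ _ → p⊆p∪q {p = S} (B u) x∈S)
      (removeAt-reflects-⊆ y (λ _ → removeAt-mono-⊆ x {S} (p⊆p∪q (B u)) y∈S)
        (removeAt-mono-⊆ y (removeAt-mono-⊆ x (q⊆p∪q S (B u))) ∘ h)))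

IsCFF-cone⁻ : ∀ {n t} {G : Graph n} {B : Fin (suc n) → Subset t} →
              IsCFF (cone G) t B → IsCFF G t (B ∘ suc)
IsCFF-cone⁻ cff a b a~b with cff (suc a) (suc b) (old a~b)
... | a⊈b , b⊈a , w⊈a∪b =
  a⊈b , b⊈a , λ w w≢a w≢b → w⊈a∪b (suc w) (w≢a ∘ suc-injective) (w≢b ∘ suc-injective)

coneFamily : ∀ {n t} → (Fin n → Subset t) → Fin (suc n) → Subset (suc t)
coneFamily B zero    = inside ∷ ⊥
coneFamily B (suc v) = outside ∷ B v

module _ {n t : ℕ} {G : Graph n} {B : Fin n → Subset t}
         (noIsolated : NoIsolated G) (cff : IsCFF G t B) where

  private
    0∉old : ∀ {p : Subset t} → zero ∉ outside ∷ p
    0∉old ()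

    ⊈-∷ : ∀ {s s′} {p q : Subset t} → ¬ (p ⊆ q) → ¬ (s ∷ p ⊆ s′ ∷ q)
    ⊈-∷ p⊈q = p⊈q ∘ drop-∷-⊆

    apexCoverFree : ∀ v → CoverFreeAt (coneFamily B) zero (suc v)
    apexCoverFree v =
      (λ h → 0∉old (h here)) ,
      (λ h → ∉⊥ (drop-there (h (there (proj₂ (IsCFF⇒Nonempty {G = G} noIsolated cff v)))))) ,
      w⊈apex∪v
      where
      w⊈apex∪v : ∀ w → w ≢ zero → w ≢ suc v →
                 ¬ (coneFamily B w ⊆ coneFamily B zero ∪ coneFamily B (suc v))
      w⊈apex∪v zero    w≢0 _   = ⊥-elim (w≢0 refl)
      w⊈apex∪v (suc w) _   w≢v =
        IsCFF⇒antichain {G = G} noIsolated cff v w (w≢v ∘ cong suc)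
        ∘ subst (B w ⊆_) (∪-identityˡ (B v)) ∘ drop-∷-⊆

  IsCFF-cone : IsCFF (cone G) (suc t) (coneFamily B)
  IsCFF-cone .(suc a) .(suc b) (old {a} {b} a~b) with cff a b a~b
  ... | a⊈b , b⊈a , w⊈a∪b = ⊈-∷ a⊈b , ⊈-∷ b⊈a , w⊈a∪b′
    where
    w⊈a∪b′ : ∀ w → w ≢ suc a → w ≢ suc b →
             ¬ (coneFamily B w ⊆ coneFamily B (suc a) ∪ coneFamily B (suc b))
    w⊈a∪b′ zero    _   _   h = 0∉old (h here)
    w⊈a∪b′ (suc w) w≢a w≢b = ⊈-∷ (w⊈a∪b w (w≢a ∘ cong suc) (w≢b ∘ cong suc))
  IsCFF-cone .zero .(suc v) (apexˡ {v}) = apexCoverFree v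
  IsCFF-cone .(suc v) .zero (apexʳ {v}) = CoverFreeAt-sym (apexCoverFree v)

HasCFF-cone : ∀ {n t} {G : Graph n} → NoIsolated G → HasCFF G t → HasCFF (cone G) (suc t)
HasCFF-cone noIsolated (B , cff) = coneFamily B , IsCFF-cone noIsolated cff

HasCFF-cone⁻ : ∀ {n t} {G : Graph n} → HasCFF (cone G) t → HasCFF G t
HasCFF-cone⁻ (B , cff) = B ∘ suc , IsCFF-cone⁻ cff

HasCFF-cone-reduces : ∀ {n t} (G : Graph n) → NoIsolated G → HasCFF (cone G) (suc t) →
                      HasCFF G t ⊎ ∃[ k ] k < t × HasAntichain n k
HasCFF-cone-reduces {zero} G _ _ = inj₁ ((λ ()) , λ ())
HasCFF-cone-reduces {suc n} G noIsolated (B , cff) with nonempty? (B zero)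
... | no empty = ⊥-elim (proj₁ (cff zero (suc zero) apexˡ) (Empty⇒⊆ empty))
... | yes (x , x∈apex) with nonempty? (removeAt (B zero) x)
...   | yes (y , y∈apex) = inj₂ (removeAt²-antichain (B zero) (B ∘ suc) x∈apex y∈apex
          λ v u v≢u → proj₂ (proj₂ (cff zero (suc u) apexˡ)) (suc v) (λ ())
                        (v≢u ∘ suc-injective))
...   | no onlyX = inj₁ (_ , IsCFF-removeAt {H = G} x x∉old (IsCFF-cone⁻ {G = G} cff))
  where
  x∉old : ∀ v → x ∉ B (suc v)
  x∉old v x∈v with noIsolated v
  ... | u , v~u = proj₂ (proj₂ (cff (suc v) (suc u) (old v~u))) zero (λ ()) (λ ())
                    (removeAt-reflects-⊆ x (λ _ → x∈p∪q⁺ (inj₁ x∈v)) (Empty⇒⊆ onlyX))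

tGraph≡-cone : ∀ {n t} (G : Graph n) → NoIsolated G →
               tGraph≡ G (suc t) → t1≡ n t → tGraph≡ (cone G) (suc (suc t))
tGraph≡-cone {t = t} G noIsolated (hasCFF , minCFF) (_ , minAntichain) =
  HasCFF-cone noIsolated hasCFF , noSmaller
  where
  noSmaller : ∀ k → k < suc (suc t) → ¬ HasCFF (cone G) k
  noSmaller k k<t+2 coneCFF with m<1+n⇒m<n∨m≡n k<t+2
  ... | inj₁ k<t+1 = minCFF k k<t+1 (HasCFF-cone⁻ coneCFF)
  ... | inj₂ refl with HasCFF-cone-reduces G noIsolated coneCFF
  ...   | inj₁ cffG                 = minCFF t (n<1+n t) cffG
  ...   | inj₂ (j , j<t , antichain) = minAntichain j j<t antichain

corollary4p16 : ∀ (n : ℕ) (G : Graph n) → NoIsolated G →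
    ∀ (tG t1 : ℕ) → tGraph≡ G tG → t1≡ n t1 → tG ≡ t1 + 1 →
    tGraph≡ (cone G) (tG + 1)
corollary4p16 n G noIsolated tG t1 tG-min t1-min tG≡t1+1 =
  subst (tGraph≡ (cone G)) (trans (cong suc (≡-sym tG≡1+t1)) (+-comm 1 tG))
    (tGraph≡-cone G noIsolated (subst (tGraph≡ G) tG≡1+t1 tG-min) t1-min)
  where
  tG≡1+t1 : tG ≡ suc t1
  tG≡1+t1 = trans tG≡t1+1 (+-comm t1 1)
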